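{- Let $q$ be a prime power and $n,r$ positive integers. Let $(U_1,\ldots,U_r)$ and $(W_1,\ldots,W_r)$ be two families each consisting of $r$ distinct $\mathbb{F}_q$-subspaces of $\mathbb{F}_{q^n}$, such that $\dim_{\mathbb{F}_q}(U_i\cap\alpha U_j)\leq 1$ and $\dim_{\mathbb{F}_q}(W_i\cap\alpha W_j)\leq 1$ for every $\alpha\in\mathbb{F}_{q^n}$ and all $i\neq j$. Let $k_i=\dim_{\mathbb{F}_q}(U_i)$ and $k_i'=\dim_{\mathbb{F}_q}(W_i)$. If $(k_1,\ldots,k_r)$ cannot be obtained from $(k_1',\ldots,k_r')$ by permuting its entries, then $\{U_1,\ldots,U_r\}$ and $\{W_1,\ldots,W_r\}$ are inequivalent.
   Context: $\mathrm{\Gamma L}(r,q^n)=\mathrm{GL}(r,q^n)\rtimes\mathrm{Aut}(\mathbb{F}_{q^n})$ acts on $\mathbb{F}_{q^n}^r$ by semilinear maps. Two families $\{U_1,\ldots,U_r\}$ and $\{W_1,\ldots,W_r\}$ of $r$ distinct $\mathbb{F}_q$-subspaces of $\mathbb{F}_{q^n}$ are called equivalent if there exists $\varphi\in\mathrm{\Gamma L}(r,q^n)$ with $\varphi(U_1\times\cdots\times U_r)=W_1\times\cdots\times W_r$. -}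

module Defs where

open import Level using (0ℓ)
open import Data.Nat as ℕ using (ℕ; zero; suc; _≤_)
open import Data.Nat.Primality using (Prime)
open import Data.Fin using (Fin; zero; suc)
open import Data.Fin.Permutation using (Permutation′; _⟨$⟩ʳ_)
open import Data.List using (List; length)
open import Data.List.Membership.Propositional using (_∈_)
open import Data.List.Relation.Unary.Unique.Propositional using (Unique)
open import Data.Product using (Σ; ∃; ∃-syntax; _×_; _,_)
open import Relation.Nullary using (¬_)
open import Relation.Binary.PropositionalEquality using (_≡_; _≢_)
open import Relation.Binary.Definitions using (DecidableEquality)
open import Algebra.Structures using (IsCommutativeRing)

IsPrimePower : ℕ → Set
IsPrimePower q = Σ ℕ λ p → Σ ℕ λ m → Prime p × (1 ≤ m) × (q ≡ p ℕ.^ m)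

record FiniteField : Set₁ where
  infixl 6 _+_
  infixl 7 _*_
  field
    Carrier  : Set
    _+_ _*_  : Carrier → Carrier → Carrier
    -_       : Carrier → Carrier
    0# 1#    : Carrier
    isCommutativeRing : IsCommutativeRing _≡_ _+_ _*_ -_ 0# 1#
    0≢1      : 0# ≢ 1#
    inverse  : ∀ x → x ≢ 0# → Σ Carrier λ y → x * y ≡ 1#
    _≟_      : DecidableEquality Carrier
    elements : List Carrier
    complete : ∀ x → x ∈ elements
    unique   : Unique elements

  card : ℕ
  card = length elements

  _^_ : Carrier → ℕ → Carrier
  x ^ zero  = 1#
  x ^ suc k = x * (x ^ k)

module _ (K : FiniteField) where
  open FiniteField K

  ΣK : ∀ {m} → (Fin m → Carrier) → Carrier
  ΣK {zero}  f = 0#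
  ΣK {suc m} f = f zero + ΣK (λ i → f (suc i))

  -- the subfield F_q of F_{q^n}: the elements fixed by x ↦ x^q
  InFq : ℕ → Carrier → Set
  InFq q a = a ^ q ≡ a

  record Subspace (q : ℕ) : Set₁ where
    field
      mem     : Carrier → Set
      0∈      : mem 0#
      +-closed : ∀ {x y} → mem x → mem y → mem (x + y)
      ·-closed : ∀ {a x} → InFq q a → mem x → mem (a * x)
  open Subspace public

  SameSet : (Carrier → Set) → (Carrier → Set) → Set
  SameSet U V = ∀ x → (U x → V x) × (V x → U x)

  _∩_ : (Carrier → Set) → (Carrier → Set) → (Carrier → Set)
  (U ∩ V) x = U x × V x

  scale : Carrier → (Carrier → Set) → (Carrier → Set)
  scale α U x = Σ Carrier λ u → U u × x ≡ α * u

  linComb : ∀ {k} → (Fin k → Carrier) → (Fin k → Carrier) → Carrier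
  linComb c v = ΣK (λ i → c i * v i)

  IsBasis : (q : ℕ) → (Carrier → Set) → ∀ {k} → (Fin k → Carrier) → Set
  IsBasis q V {k} v =
      (∀ i → V (v i))
    × (∀ (c : Fin k → Carrier) → (∀ i → InFq q (c i)) →
         linComb c v ≡ 0# → ∀ i → c i ≡ 0#)
    × (∀ x → V x → Σ (Fin k → Carrier) λ c → (∀ i → InFq q (c i)) × linComb c v ≡ x)

  HasDim : (q : ℕ) → (Carrier → Set) → ℕ → Set
  HasDim q V k = Σ (Fin k → Carrier) λ v → IsBasis q V v

  IsAutomorphism : (Carrier → Carrier) → Set
  IsAutomorphism σ =
      (∀ x y → σ (x + y) ≡ σ x + σ y)
    × (∀ x y → σ (x * y) ≡ σ x * σ y)
    × (σ 1# ≡ 1#)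
    × (Σ (Carrier → Carrier) λ τ → (∀ x → τ (σ x) ≡ x) × (∀ x → σ (τ x) ≡ x))

  Matrix : ℕ → Set
  Matrix r = Fin r → Fin r → Carrier

  _·_ : ∀ {r} → Matrix r → (Fin r → Carrier) → (Fin r → Carrier)
  (A · v) i = ΣK (λ j → A i j * v j)

  idM : ∀ {r} → Matrix r
  idM i j with i Data.Fin.≟ j
  ... | Relation.Nullary.yes _ = 1#
  ... | Relation.Nullary.no  _ = 0#

  _⊗_ : ∀ {r} → Matrix r → Matrix r → Matrix r
  (A ⊗ B) i j = ΣK (λ l → A i l * B l j)

  Invertible : ∀ {r} → Matrix r → Set
  Invertible {r} A = Σ (Matrix r) λ B →
    (∀ i j → (A ⊗ B) i j ≡ idM i j) × (∀ i j → (B ⊗ A) i j ≡ idM i j)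

  semilinear : ∀ {r} → Matrix r → (Carrier → Carrier) → (Fin r → Carrier) → (Fin r → Carrier)
  semilinear A σ x = A · (λ i → σ (x i))

  InProduct : ∀ {q r} → (Fin r → Subspace q) → (Fin r → Carrier) → Set
  InProduct U x = ∀ i → mem (U i) (x i)

  -- φ(U_1 × ⋯ × U_r) = W_1 × ⋯ × W_r for some φ ∈ ΓL(r, q^n)
  Equivalent : ∀ {q r} → (Fin r → Subspace q) → (Fin r → Subspace q) → Set
  Equivalent {q} {r} U W =
    Σ (Matrix r) λ A → Σ (Carrier → Carrier) λ σ →
      Invertible A × IsAutomorphism σ
      × (∀ x → InProduct U x → InProduct W (semilinear A σ x))
      × (∀ y → InProduct W y →
           Σ (Fin r → Carrier) λ x → InProduct U x × (∀ i → semilinear A σ x i ≡ y i))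

  Distinct : ∀ {q r} → (Fin r → Subspace q) → Set
  Distinct U = ∀ i j → i ≢ j → ¬ SameSet (mem (U i)) (mem (U j))

  ScatteredCond : ∀ {q r} → (Fin r → Subspace q) → Set
  ScatteredCond {q} U = ∀ (α : Carrier) i j → i ≢ j → ∀ d →
    HasDim q (mem (U i) ∩ scale α (mem (U j))) d → d ≤ 1

IsPermutationOf : ∀ {r} → (Fin r → ℕ) → (Fin r → ℕ) → Set
IsPermutationOf {r} k k′ = Σ (Permutation′ r) λ π → ∀ i → k i ≡ k′ (π ⟨$⟩ʳ i)

module Submission where

-- If (A, σ) is a ΓL-equivalence with A⁻¹ = B, then for x ∈ U_j the vector with x in place j and
-- 0 elsewhere is sent to a vector with i-th entry A_ij σ(x) ∈ W_i, and for w ∈ W_i the preimage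
-- of the vector with w in place i has j-th entry σ⁻¹(B_ji w) ∈ U_j. Both maps are injective and
-- semilinear over F_q, the fixed field of x ↦ x^q (a subfield by the Frobenius identity), so the
-- Steinitz exchange lemma gives k_j ≤ k′_i whenever A_ij ≠ 0 and k′_i ≤ k_j whenever B_ji ≠ 0.
-- For mutually inverse matrices such bounds force k to be a permutation of k′: a nonzero term
-- of (BA)_00 = 1 gives a pivot i₀ with k_0 = k′_i₀, and Gaussian elimination at that pivot
-- reduces the size.

open import Defs
open import Data.Nat using (ℕ; _≤_; _^_)
open import Data.Fin using (Fin)
open import Data.Product using (_×_)
open import Relation.Nullary using (¬_)
open import Relation.Binary.PropositionalEquality using (_≡_)

open import Level using (0ℓ)
open import Algebra.Bundles using (CommutativeRing)
import Algebra.Properties.CommutativeSemigroup as CommutativeSemigroupProperties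
import Algebra.Properties.CommutativeSemiring.Binomial as BinomialProperties
import Algebra.Properties.CommutativeSemiring.Exp as ExpProperties
import Algebra.Properties.Ring as RingProperties
import Algebra.Properties.Semiring.Mult as MultProperties
import Algebra.Properties.Semiring.Sum as SumProperties
open import Data.Empty using (⊥-elim)
open import Data.Fin as Fin using (zero; suc; punchIn; toℕ; fromℕ)
import Data.Fin.Permutation as Perm
open import Data.Fin.Permutation using (_⟨$⟩ʳ_)
open import Data.Fin.Properties
  using (punchInᵢ≢i; punchIn-injective; suc-injective; any?; toℕ<n; toℕ-inject₁; toℕ-fromℕ)
open import Data.List using (List; []; _∷_; foldr; map; length)
open import Data.List.Membership.Propositional using (_∈_)
open import Data.List.Membership.Propositional.Properties using (∈-map⁺)
open import Data.List.Membership.Propositional.Properties.WithK using (unique∧set⇒bag)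
open import Data.List.Relation.Binary.BagAndSetEquality using (∼bag⇒↭; _∼[_]_; set)
open import Data.List.Relation.Binary.Permutation.Propositional using (_↭_; ↭⇒↭ₛ)
import Data.List.Relation.Binary.Permutation.Setoid.Properties as PermutationProperties
import Data.List.Relation.Unary.Unique.Propositional.Properties as Unique
open import Data.Nat as ℕ using (zero; suc; _∸_; z≤n; s≤s)
open import Data.Nat.Combinatorics using (_C_; nC1≡n; nCn≡1; nCk+nC[k+1]≡[n+1]C[k+1])
open import Data.Nat.Divisibility using (_∣_; divides; >⇒∤)
open import Data.Nat.Primality using (Prime; ¬prime[0]; euclidsLemma)
import Data.Nat.Properties as ℕₚ
open import Data.Product using (Σ; _,_; proj₁; proj₂)
open import Data.Sum using (_⊎_; inj₁; inj₂)
open import Data.Vec.Functional using (init; insertAt; updateAt)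
open import Data.Vec.Functional.Properties
  using (insertAt-lookup; insertAt-punchIn; updateAt-updates; updateAt-minimal)
open import Function using (_∘_)
open import Function.Bundles using (mk⇔)
import Relation.Binary.PropositionalEquality as ≡
open import Relation.Binary.PropositionalEquality
  using (_≢_; refl; sym; trans; cong; cong₂; subst; module ≡-Reasoning)
open import Relation.Nullary using (yes; no; ¬?)
open import Relation.Nullary.Decidable using (decidable-stable)

insertAt-∀ : ∀ {a p} {A : Set a} {P : A → Set p} {n} (xs : Fin n → A) i {x} →
  P x → (∀ j → P (xs j)) → ∀ l → P (insertAt xs i x l)
insertAt-∀                     xs zero    Px Pxs zero    = Px
insertAt-∀                     xs zero    Px Pxs (suc l) = Pxs l
insertAt-∀         {n = suc n} xs (suc i) Px Pxs zero    = Pxs zero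
insertAt-∀ {P = P} {n = suc n} xs (suc i) Px Pxs (suc l) =
  insertAt-∀ {P = P} (xs ∘ suc) i Px (Pxs ∘ suc) l

module FieldProperties (K : FiniteField) where
  open FiniteField K hiding (_^_)
  open ≡-Reasoning

  commutativeRing : CommutativeRing 0ℓ 0ℓ
  commutativeRing = record { isCommutativeRing = isCommutativeRing }

  open CommutativeRing commutativeRing public
    using ( +-assoc; +-comm; +-identityˡ; +-identityʳ; -‿inverseˡ; -‿inverseʳ
          ; *-assoc; *-comm; *-identityˡ; *-identityʳ; distribˡ; distribʳ; zeroˡ; zeroʳ
          ; +-isCommutativeMonoid; semiring; commutativeSemiring
          ; +-commutativeSemigroup; *-commutativeSemigroup )
  open RingProperties (CommutativeRing.ring commutativeRing) public
    using ( -‿distribˡ-*; -‿distribʳ-*; -‿involutive; -0#≈0#; -‿+-comm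
          ; +-cancelʳ; +-inverseʳ-unique; +-identityʳ-unique; x+x≈x⇒x≈0 )
  open ExpProperties commutativeSemiring public
    using (^-distrib-*; ^-assocʳ) renaming (_^_ to _^ᴷ_)
  open MultProperties semiring public using (×1-homo-*; ×-assoc-*) renaming (_×_ to _×ᴷ_)
  module +-Semigroup = CommutativeSemigroupProperties +-commutativeSemigroup
  module *-Semigroup = CommutativeSemigroupProperties *-commutativeSemigroup

  ^≡^ᴷ : ∀ x n → FiniteField._^_ K x n ≡ x ^ᴷ n
  ^≡^ᴷ x zero    = refl
  ^≡^ᴷ x (suc n) = cong (x *_) (^≡^ᴷ x n)

  1^n≡1 : ∀ n → 1# ^ᴷ n ≡ 1#
  1^n≡1 zero    = refl
  1^n≡1 (suc n) = trans (*-identityˡ _) (1^n≡1 n)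

  invert : ∀ x → x ≢ 0# → Carrier
  invert x x≢0 = proj₁ (inverse x x≢0)

  *-inverseʳ : ∀ x (x≢0 : x ≢ 0#) → x * invert x x≢0 ≡ 1#
  *-inverseʳ x x≢0 = proj₂ (inverse x x≢0)

  *-inverseˡ : ∀ x (x≢0 : x ≢ 0#) → invert x x≢0 * x ≡ 1#
  *-inverseˡ x x≢0 = trans (*-comm _ x) (*-inverseʳ x x≢0)

  1≢0 : 1# ≢ 0#
  1≢0 = 0≢1 ∘ sym

  x≢0⇒x*y≡0⇒y≡0 : ∀ {x y} → x ≢ 0# → x * y ≡ 0# → y ≡ 0#
  x≢0⇒x*y≡0⇒y≡0 {x} {y} x≢0 xy≡0 = begin
    y                      ≡⟨ sym (*-identityˡ y) ⟩
    1# * y                 ≡⟨ cong (_* y) (sym (*-inverseˡ x x≢0)) ⟩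
    invert x x≢0 * x * y   ≡⟨ *-assoc _ x y ⟩
    invert x x≢0 * (x * y) ≡⟨ cong (invert x x≢0 *_) xy≡0 ⟩
    invert x x≢0 * 0#      ≡⟨ zeroʳ _ ⟩
    0#                     ∎

  x*y≢0⇒x≢0 : ∀ {x y} → x * y ≢ 0# → x ≢ 0#
  x*y≢0⇒x≢0 {x} {y} xy≢0 x≡0 = xy≢0 (trans (cong (_* y) x≡0) (zeroˡ y))

  x*y≢0⇒y≢0 : ∀ {x y} → x * y ≢ 0# → y ≢ 0#
  x*y≢0⇒y≢0 {x} {y} xy≢0 y≡0 = xy≢0 (trans (cong (x *_) y≡0) (zeroʳ x))

  *-cancelʳ-nonzero : ∀ {a x y} → a ≢ 0# → x * a ≡ y * a → x ≡ y
  *-cancelʳ-nonzero {a} {x} {y} a≢0 xa≡ya = begin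
    x                      ≡⟨ sym (*-identityʳ x) ⟩
    x * 1#                 ≡⟨ cong (x *_) (sym (*-inverseʳ a a≢0)) ⟩
    x * (a * invert a a≢0) ≡⟨ sym (*-assoc x a _) ⟩
    x * a * invert a a≢0   ≡⟨ cong (_* invert a a≢0) xa≡ya ⟩
    y * a * invert a a≢0   ≡⟨ *-assoc y a _ ⟩
    y * (a * invert a a≢0) ≡⟨ cong (y *_) (*-inverseʳ a a≢0) ⟩
    y * 1#                 ≡⟨ *-identityʳ y ⟩
    y                      ∎

  x+[-xy⁻¹]y≡0 : ∀ x y (y≢0 : y ≢ 0#) → x + - (x * invert y y≢0) * y ≡ 0#
  x+[-xy⁻¹]y≡0 x y y≢0 = begin
    x + - (x * y⁻¹) * y
      ≡⟨ cong (x +_) (sym (-‿distribˡ-* (x * y⁻¹) y)) ⟩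
    x + - (x * y⁻¹ * y)
      ≡⟨ cong (λ u → x + - u) (trans (*-assoc x y⁻¹ y) (cong (x *_) (*-inverseˡ y y≢0))) ⟩
    x + - (x * 1#)
      ≡⟨ cong (λ u → x + - u) (*-identityʳ x) ⟩
    x + - x
      ≡⟨ -‿inverseʳ x ⟩
    0# ∎
    where y⁻¹ = invert y y≢0

  a+db≡0⇒[aw+s]+d[bw+t]≡s+dt : ∀ a b d s t w → a + d * b ≡ 0# →
    (a * w + s) + d * (b * w + t) ≡ s + d * t
  a+db≡0⇒[aw+s]+d[bw+t]≡s+dt a b d s t w a+db≡0 = begin
    (a * w + s) + d * (b * w + t)          ≡⟨ cong ((a * w + s) +_) (distribˡ d (b * w) t) ⟩
    (a * w + s) + (d * (b * w) + d * t)    ≡⟨ +-Semigroup.interchange (a * w) s _ _ ⟩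
    (a * w + d * (b * w)) + (s + d * t)    ≡⟨ cong (_+ (s + d * t)) aw+dbw≡0 ⟩
    0# + (s + d * t)                       ≡⟨ +-identityˡ _ ⟩
    s + d * t                              ∎
    where
    aw+dbw≡0 : a * w + d * (b * w) ≡ 0#
    aw+dbw≡0 = begin
      a * w + d * (b * w)  ≡⟨ cong (a * w +_) (sym (*-assoc d b w)) ⟩
      a * w + d * b * w    ≡⟨ sym (distribʳ w a (d * b)) ⟩
      (a + d * b) * w      ≡⟨ cong (_* w) a+db≡0 ⟩
      0# * w               ≡⟨ zeroˡ w ⟩
      0#                   ∎

  x^n≡0⇒x≡0 : ∀ x n → x ^ᴷ n ≡ 0# → x ≡ 0#
  x^n≡0⇒x≡0 x zero    1≡0   = ⊥-elim (1≢0 1≡0)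
  x^n≡0⇒x≡0 x (suc n) x^n≡0 with x ≟ 0#
  ... | yes x≡0 = x≡0
  ... | no  x≢0 = x^n≡0⇒x≡0 x n (x≢0⇒x*y≡0⇒y≡0 x≢0 x^n≡0)

module Sums (K : FiniteField) where
  open FiniteField K hiding (_^_)
  open FieldProperties K
  open SumProperties semiring using (sum; sum-remove; ∑-distrib-+; *-distribˡ-sum; *-distribʳ-sum)
  open ≡-Reasoning

  ΣK≡sum : ∀ {m} (f : Fin m → Carrier) → ΣK K f ≡ sum f
  ΣK≡sum {zero}  f = refl
  ΣK≡sum {suc m} f = cong (f zero +_) (ΣK≡sum (f ∘ suc))

  ΣK-cong : ∀ {m} {f g : Fin m → Carrier} → (∀ i → f i ≡ g i) → ΣK K f ≡ ΣK K g
  ΣK-cong {zero}  f≗g = refl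
  ΣK-cong {suc m} f≗g = cong₂ _+_ (f≗g zero) (ΣK-cong (f≗g ∘ suc))

  ΣK-zero : ∀ {m} (f : Fin m → Carrier) → (∀ i → f i ≡ 0#) → ΣK K f ≡ 0#
  ΣK-zero {zero}  f f≗0 = refl
  ΣK-zero {suc m} f f≗0 = trans (cong₂ _+_ (f≗0 zero) (ΣK-zero (f ∘ suc) (f≗0 ∘ suc))) (+-identityˡ 0#)

  ΣK-distrib-+ : ∀ {m} (f g : Fin m → Carrier) → ΣK K (λ i → f i + g i) ≡ ΣK K f + ΣK K g
  ΣK-distrib-+ f g = begin
    ΣK K (λ i → f i + g i)  ≡⟨ ΣK≡sum (λ i → f i + g i) ⟩
    sum (λ i → f i + g i)   ≡⟨ ∑-distrib-+ f g ⟩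
    sum f + sum g           ≡⟨ sym (cong₂ _+_ (ΣK≡sum f) (ΣK≡sum g)) ⟩
    ΣK K f + ΣK K g         ∎

  *-distribˡ-ΣK : ∀ {m} x (f : Fin m → Carrier) → x * ΣK K f ≡ ΣK K (λ i → x * f i)
  *-distribˡ-ΣK x f = begin
    x * ΣK K f              ≡⟨ cong (x *_) (ΣK≡sum f) ⟩
    x * sum f               ≡⟨ *-distribˡ-sum x f ⟩
    sum (λ i → x * f i)     ≡⟨ sym (ΣK≡sum (λ i → x * f i)) ⟩
    ΣK K (λ i → x * f i)    ∎

  *-distribʳ-ΣK : ∀ {m} x (f : Fin m → Carrier) → ΣK K f * x ≡ ΣK K (λ i → f i * x)
  *-distribʳ-ΣK x f = begin
    ΣK K f * x              ≡⟨ cong (_* x) (ΣK≡sum f) ⟩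
    sum f * x               ≡⟨ *-distribʳ-sum x f ⟩
    sum (λ i → f i * x)     ≡⟨ sym (ΣK≡sum (λ i → f i * x)) ⟩
    ΣK K (λ i → f i * x)    ∎

  -‿distrib-ΣK : ∀ {m} (f : Fin m → Carrier) → - ΣK K f ≡ ΣK K (λ i → - f i)
  -‿distrib-ΣK {zero}  f = -0#≈0#
  -‿distrib-ΣK {suc m} f = trans (sym (-‿+-comm (f zero) _)) (cong (- f zero +_) (-‿distrib-ΣK (f ∘ suc)))

  ΣK-comm : ∀ {m n} (f : Fin m → Fin n → Carrier) →
    ΣK K (λ i → ΣK K (f i)) ≡ ΣK K (λ j → ΣK K (λ i → f i j))
  ΣK-comm {zero} {n} f = sym (ΣK-zero {n} (λ _ → 0#) (λ _ → refl))
  ΣK-comm {suc m} f = trans (cong (ΣK K (f zero) +_) (ΣK-comm (f ∘ suc)))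
                            (sym (ΣK-distrib-+ (f zero) (λ j → ΣK K (λ i → f (suc i) j))))

  ΣK-remove : ∀ {m} (i : Fin (suc m)) (f : Fin (suc m) → Carrier) →
    ΣK K f ≡ f i + ΣK K (f ∘ punchIn i)
  ΣK-remove i f = begin
    ΣK K f                     ≡⟨ ΣK≡sum f ⟩
    sum f                      ≡⟨ sum-remove f ⟩
    f i + sum (f ∘ punchIn i)  ≡⟨ cong (f i +_) (sym (ΣK≡sum (f ∘ punchIn i))) ⟩
    f i + ΣK K (f ∘ punchIn i) ∎

  ΣK-single : ∀ {m} (j : Fin m) (f : Fin m → Carrier) → (∀ i → i ≢ j → f i ≡ 0#) → ΣK K f ≡ f j
  ΣK-single {suc m} j f f≡0 = begin
    ΣK K f                      ≡⟨ ΣK-remove j f ⟩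
    f j + ΣK K (f ∘ punchIn j)  ≡⟨ cong (f j +_) (ΣK-zero _ (λ i → f≡0 (punchIn j i) (punchInᵢ≢i j i))) ⟩
    f j + 0#                    ≡⟨ +-identityʳ (f j) ⟩
    f j                         ∎

  ΣK-linearˡ : ∀ {m} (a g b : Fin m → Carrier) μ →
    ΣK K (λ j → (a j + μ * g j) * b j) ≡ ΣK K (λ j → a j * b j) + μ * ΣK K (λ j → g j * b j)
  ΣK-linearˡ a g b μ = begin
    ΣK K (λ j → (a j + μ * g j) * b j)
      ≡⟨ ΣK-cong (λ j → trans (distribʳ (b j) (a j) _) (cong (a j * b j +_) (*-assoc μ (g j) (b j)))) ⟩
    ΣK K (λ j → a j * b j + μ * (g j * b j))
      ≡⟨ ΣK-distrib-+ (λ j → a j * b j) (λ j → μ * (g j * b j)) ⟩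
    ΣK K (λ j → a j * b j) + ΣK K (λ j → μ * (g j * b j))
      ≡⟨ cong (ΣK K (λ j → a j * b j) +_) (sym (*-distribˡ-ΣK μ (λ j → g j * b j))) ⟩
    ΣK K (λ j → a j * b j) + μ * ΣK K (λ j → g j * b j) ∎

  ΣK-linearʳ : ∀ {m} (b a c : Fin m → Carrier) g →
    ΣK K (λ j → b j * (a j + c j * g)) ≡ ΣK K (λ j → b j * a j) + ΣK K (λ j → b j * c j) * g
  ΣK-linearʳ b a c g = begin
    ΣK K (λ j → b j * (a j + c j * g))
      ≡⟨ ΣK-cong (λ j → trans (distribˡ (b j) (a j) _) (cong (b j * a j +_) (sym (*-assoc (b j) (c j) g)))) ⟩
    ΣK K (λ j → b j * a j + b j * c j * g)
      ≡⟨ ΣK-distrib-+ (λ j → b j * a j) (λ j → b j * c j * g) ⟩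
    ΣK K (λ j → b j * a j) + ΣK K (λ j → b j * c j * g)
      ≡⟨ cong (ΣK K (λ j → b j * a j) +_) (sym (*-distribʳ-ΣK g (λ j → b j * c j))) ⟩
    ΣK K (λ j → b j * a j) + ΣK K (λ j → b j * c j) * g ∎

  ΣK≢0⇒∃≢0 : ∀ {m} (f : Fin m → Carrier) → ΣK K f ≢ 0# → Σ (Fin m) λ i → f i ≢ 0#
  ΣK≢0⇒∃≢0 f Σf≢0 with any? (λ i → ¬? (f i ≟ 0#))
  ... | yes nonzero = nonzero
  ... | no  ∄nonzero =
    ⊥-elim (Σf≢0 (ΣK-zero f (λ i → decidable-stable (f i ≟ 0#) (∄nonzero ∘ (i ,_)))))

module Matrices (K : FiniteField) where
  open FiniteField K hiding (_^_)
  open FieldProperties K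
  open Sums K
  open ≡-Reasoning

  infixl 7 _⊗ᴷ_
  _⊗ᴷ_ : ∀ {r} → Matrix K r → Matrix K r → Matrix K r
  _⊗ᴷ_ = _⊗_ K

  infixr 7 _·ᴷ_
  _·ᴷ_ : ∀ {r} → Matrix K r → (Fin r → Carrier) → Fin r → Carrier
  _·ᴷ_ = _·_ K

  idM-diagonal : ∀ {r} (i : Fin r) → idM K i i ≡ 1#
  idM-diagonal i with i Fin.≟ i
  ... | yes _   = refl
  ... | no  i≢i = ⊥-elim (i≢i refl)

  idM-offDiagonal : ∀ {r} {i j : Fin r} → i ≢ j → idM K i j ≡ 0#
  idM-offDiagonal {i = i} {j} i≢j with i Fin.≟ j
  ... | yes i≡j = ⊥-elim (i≢j i≡j)
  ... | no  _   = refl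

  idM-injective : ∀ {r s} (g : Fin r → Fin s) → (∀ {a b} → g a ≡ g b → a ≡ b) →
    ∀ i j → idM K (g i) (g j) ≡ idM K i j
  idM-injective g g-injective i j with i Fin.≟ j
  ... | yes refl = idM-diagonal (g i)
  ... | no  i≢j  = idM-offDiagonal (i≢j ∘ g-injective)

  left-inverse-· : ∀ {r} (A B : Matrix K r) → (∀ i j → (B ⊗ᴷ A) i j ≡ idM K i j) →
    ∀ z j → (B ·ᴷ A ·ᴷ z) j ≡ z j
  left-inverse-· A B B⊗A≡I z j = begin
    ΣK K (λ l → B j l * ΣK K (λ m → A l m * z m))
      ≡⟨ ΣK-cong (λ l → *-distribˡ-ΣK (B j l) (λ m → A l m * z m)) ⟩
    ΣK K (λ l → ΣK K (λ m → B j l * (A l m * z m)))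
      ≡⟨ ΣK-comm (λ l m → B j l * (A l m * z m)) ⟩
    ΣK K (λ m → ΣK K (λ l → B j l * (A l m * z m)))
      ≡⟨ ΣK-cong (λ m → trans (ΣK-cong (λ l → sym (*-assoc (B j l) (A l m) (z m))))
                              (sym (*-distribʳ-ΣK (z m) (λ l → B j l * A l m)))) ⟩
    ΣK K (λ m → (B ⊗ᴷ A) j m * z m)
      ≡⟨ ΣK-single j _ (λ m m≢j → trans (cong (_* z m) (trans (B⊗A≡I j m) (idM-offDiagonal (m≢j ∘ sym))))
                                         (zeroˡ (z m))) ⟩
    (B ⊗ᴷ A) j j * z j
      ≡⟨ cong (_* z j) (trans (B⊗A≡I j j) (idM-diagonal j)) ⟩
    1# * z j
      ≡⟨ *-identityˡ (z j) ⟩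
    z j ∎

module Characteristic (K : FiniteField) where
  open FiniteField K hiding (_^_)
  open FieldProperties K
  open PermutationProperties (≡.setoid Carrier) using (foldr-commMonoid)
  open ≡-Reasoning

  sumList : List Carrier → Carrier
  sumList = foldr _+_ 0#

  sumList-map-+ : ∀ a xs → sumList (map (_+ a) xs) ≡ sumList xs + length xs ×ᴷ a
  sumList-map-+ a []       = sym (+-identityˡ 0#)
  sumList-map-+ a (x ∷ xs) = begin
    x + a + sumList (map (_+ a) xs)   ≡⟨ cong (x + a +_) (sumList-map-+ a xs) ⟩
    x + a + (sumList xs + n ×ᴷ a)      ≡⟨ +-Semigroup.interchange x a (sumList xs) (n ×ᴷ a) ⟩
    x + sumList xs + (a + n ×ᴷ a)      ∎
    where n = length xs

  translation↭elements : ∀ a → map (_+ a) elements ↭ elements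
  translation↭elements a =
    ∼bag⇒↭ (unique∧set⇒bag (Unique.map⁺ (+-cancelʳ _ _ _) unique) unique sameSet)
    where
    x-a+a≡x : ∀ x → x + - a + a ≡ x
    x-a+a≡x x = trans (+-assoc x (- a) a) (trans (cong (x +_) (-‿inverseˡ a)) (+-identityʳ x))
    sameSet : map (_+ a) elements ∼[ set ] elements
    sameSet {x} = mk⇔ (λ _ → complete x)
      (λ _ → subst (_∈ map (_+ a) elements) (x-a+a≡x x) (∈-map⁺ (_+ a) (complete (x + - a))))

  -- Adding 1# to every element permutes K, so adding card ×ᴷ 1# to the sum of all elements
  -- does not change it.
  card×1≡0 : card ×ᴷ 1# ≡ 0#
  card×1≡0 = +-identityʳ-unique (sumList elements) (card ×ᴷ 1#) (begin
    sumList elements + card ×ᴷ 1#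
      ≡⟨ sym (sumList-map-+ 1# elements) ⟩
    sumList (map (_+ 1#) elements)
      ≡⟨ foldr-commMonoid +-isCommutativeMonoid (↭⇒↭ₛ (translation↭elements 1#)) ⟩
    sumList elements ∎)

  ×1-homo-^ : ∀ p e → (p ^ e) ×ᴷ 1# ≡ (p ×ᴷ 1#) ^ᴷ e
  ×1-homo-^ p zero    = +-identityʳ 1#
  ×1-homo-^ p (suc e) = trans (×1-homo-* p (p ^ e)) (cong ((p ×ᴷ 1#) *_) (×1-homo-^ p e))

  card≡p^e⇒p×1≡0 : ∀ p e → card ≡ p ^ e → p ×ᴷ 1# ≡ 0#
  card≡p^e⇒p×1≡0 p e card≡p^e =
    x^n≡0⇒x≡0 (p ×ᴷ 1#) e (begin
      (p ×ᴷ 1#) ^ᴷ e   ≡⟨ sym (×1-homo-^ p e) ⟩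
      (p ^ e) ×ᴷ 1#    ≡⟨ cong (_×ᴷ 1#) (sym card≡p^e) ⟩
      card ×ᴷ 1#       ≡⟨ card×1≡0 ⟩
      0#               ∎)

module BinomialCoefficients where
  open import Data.Nat using (_+_; _*_; _<_)

  absorption : ∀ n k → suc k * (suc n C suc k) ≡ suc n * (n C k)
  absorption n       zero    =
    trans (ℕₚ.*-identityˡ _) (trans (nC1≡n (suc n)) (sym (ℕₚ.*-identityʳ (suc n))))
  absorption zero    (suc k) = ℕₚ.*-zeroʳ (suc (suc k))
  absorption (suc n) (suc k) = begin
    suc (suc k) * (suc (suc n) C suc (suc k))
      ≡⟨ cong (suc (suc k) *_) (sym (nCk+nC[k+1]≡[n+1]C[k+1] (suc n) (suc k))) ⟩
    suc (suc k) * (a + b)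
      ≡⟨ ℕₚ.*-distribˡ-+ (suc (suc k)) a b ⟩
    (a + suc k * a) + suc (suc k) * b
      ≡⟨ cong₂ (λ u v → (a + u) + v) (absorption n k) (absorption n (suc k)) ⟩
    (a + suc n * (n C k)) + suc n * (n C suc k)
      ≡⟨ ℕₚ.+-assoc a _ _ ⟩
    a + (suc n * (n C k) + suc n * (n C suc k))
      ≡⟨ cong (a +_) (sym (ℕₚ.*-distribˡ-+ (suc n) (n C k) (n C suc k))) ⟩
    a + suc n * (n C k + n C suc k)
      ≡⟨ cong (λ u → a + suc n * u) (nCk+nC[k+1]≡[n+1]C[k+1] n k) ⟩
    a + suc n * a ∎
    where
    open ≡-Reasoning
    a = suc n C suc k
    b = suc n C suc (suc k)

  prime∣pCk : ∀ {p k} → Prime p → 0 < k → k < p → p ∣ p C k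
  prime∣pCk {zero}  {k}     p-prime _   _   = ⊥-elim (¬prime[0] p-prime)
  prime∣pCk {suc n} {suc j} p-prime 0<k k<p with euclidsLemma (suc j) (suc n C suc j) p-prime p∣k*pCk
    where
    p∣k*pCk : suc n ∣ suc j * (suc n C suc j)
    p∣k*pCk = divides (n C j) (trans (absorption n j) (ℕₚ.*-comm (suc n) (n C j)))
  ... | inj₁ p∣k    = ⊥-elim (>⇒∤ k<p p∣k)
  ... | inj₂ p∣pCk = p∣pCk

module Frobenius (K : FiniteField) where
  open FiniteField K hiding (_^_)
  open FieldProperties K
  open SumProperties semiring using (sum; sum-cong-≗; sum-init-last; sum-replicate-zero)
  open BinomialProperties commutativeSemiring using (binomialTerm; theorem)
  open BinomialCoefficients using (prime∣pCk)
  open ≡-Reasoning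

  ×ᴷ≡×1* : ∀ n x → n ×ᴷ x ≡ (n ×ᴷ 1#) * x
  ×ᴷ≡×1* n x = trans (cong (n ×ᴷ_) (sym (*-identityˡ x))) (sym (×-assoc-* n 1# x))

  multiple-of-characteristic-×≡0 : ∀ {p n} → p ×ᴷ 1# ≡ 0# → ∀ x → p ∣ n → n ×ᴷ x ≡ 0#
  multiple-of-characteristic-×≡0 {p} {n} p×1≡0 x (divides c n≡c*p) = begin
    n ×ᴷ x                         ≡⟨ ×ᴷ≡×1* n x ⟩
    (n ×ᴷ 1#) * x                  ≡⟨ cong (λ m → (m ×ᴷ 1#) * x) n≡c*p ⟩
    ((c ℕ.* p) ×ᴷ 1#) * x          ≡⟨ cong (_* x) (×1-homo-* c p) ⟩
    (c ×ᴷ 1#) * (p ×ᴷ 1#) * x      ≡⟨ cong (λ u → (c ×ᴷ 1#) * u * x) p×1≡0 ⟩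
    (c ×ᴷ 1#) * 0# * x             ≡⟨ cong (_* x) (zeroʳ _) ⟩
    0# * x                         ≡⟨ zeroˡ x ⟩
    0#                             ∎

  frobenius : ∀ {p} → Prime p → p ×ᴷ 1# ≡ 0# → ∀ x y → (x + y) ^ᴷ p ≡ x ^ᴷ p + y ^ᴷ p
  frobenius {zero}  p-prime = ⊥-elim (¬prime[0] p-prime)
  frobenius {suc n} p-prime p×1≡0 x y = begin
    (x + y) ^ᴷ p
      ≡⟨ theorem p x y ⟩
    term zero + sum (term ∘ suc)
      ≡⟨ cong (term zero +_) (sum-init-last (term ∘ suc)) ⟩
    term zero + (sum (init (term ∘ suc)) + term (suc (fromℕ n)))
      ≡⟨ cong₂ (λ u v → u + (v + term (suc (fromℕ n)))) first≡y^p
               (trans (sum-cong-≗ middle≡0) (sum-replicate-zero n)) ⟩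
    y ^ᴷ p + (0# + term (suc (fromℕ n)))
      ≡⟨ cong (y ^ᴷ p +_) (trans (+-identityˡ _) (last≡x^p (toℕ (fromℕ n)) (toℕ-fromℕ n))) ⟩
    y ^ᴷ p + x ^ᴷ p
      ≡⟨ +-comm _ _ ⟩
    x ^ᴷ p + y ^ᴷ p ∎
    where
    p = suc n
    term = binomialTerm x y p
    first≡y^p : term zero ≡ y ^ᴷ p
    first≡y^p = trans (+-identityʳ _) (*-identityˡ _)
    middle≡0 : ∀ i → init (term ∘ suc) i ≡ 0#
    middle≡0 i = multiple-of-characteristic-×≡0 p×1≡0 _
      (prime∣pCk p-prime (s≤s z≤n) (s≤s (subst (ℕ._< n) (sym (toℕ-inject₁ i)) (toℕ<n i))))
    last≡x^p : ∀ t → t ≡ n → (p C suc t) ×ᴷ (x ^ᴷ suc t * y ^ᴷ (p ∸ suc t)) ≡ x ^ᴷ p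
    last≡x^p .n refl = begin
      (p C p) ×ᴷ (x ^ᴷ p * y ^ᴷ (n ∸ n))
        ≡⟨ cong₂ (λ c e → c ×ᴷ (x ^ᴷ p * y ^ᴷ e)) (nCn≡1 p) (ℕₚ.n∸n≡0 n) ⟩
      1 ×ᴷ (x ^ᴷ p * 1#)
        ≡⟨ +-identityʳ _ ⟩
      x ^ᴷ p * 1#
        ≡⟨ *-identityʳ _ ⟩
      x ^ᴷ p ∎

module Subfields (K : FiniteField) where
  open FiniteField K hiding (_^_)
  open FieldProperties K
  open Frobenius K using (frobenius)
  open ≡-Reasoning

  record IsSubfield (F : Carrier → Set) : Set where
    field
      0#∈     : F 0#
      1#∈     : F 1#
      +∈      : ∀ {a b} → F a → F b → F (a + b)
      -∈      : ∀ {a} → F a → F (- a)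
      *∈      : ∀ {a b} → F a → F b → F (a * b)
      invert∈ : ∀ {a} (a≢0 : a ≢ 0#) → F a → F (invert a a≢0)

    ΣK∈ : ∀ {m} (f : Fin m → Carrier) → (∀ i → F (f i)) → F (ΣK K f)
    ΣK∈ {zero}  f f∈ = 0#∈
    ΣK∈ {suc m} f f∈ = +∈ (f∈ zero) (ΣK∈ (f ∘ suc) (f∈ ∘ suc))

  IsSubfield-resp : ∀ {F G} → (∀ {a} → F a → G a) → (∀ {a} → G a → F a) →
    IsSubfield F → IsSubfield G
  IsSubfield-resp F⇒G G⇒F F-subfield = record
    { 0#∈     = F⇒G 0#∈
    ; 1#∈     = F⇒G 1#∈
    ; +∈      = λ a∈ b∈ → F⇒G (+∈ (G⇒F a∈) (G⇒F b∈))
    ; -∈      = λ a∈ → F⇒G (-∈ (G⇒F a∈))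
    ; *∈      = λ a∈ b∈ → F⇒G (*∈ (G⇒F a∈) (G⇒F b∈))
    ; invert∈ = λ a≢0 a∈ → F⇒G (invert∈ a≢0 (G⇒F a∈))
    }
    where open IsSubfield F-subfield

  module _ {p} (p-prime : Prime p) (p×1≡0 : p ×ᴷ 1# ≡ 0#) where

    frobenius-^ : ∀ e x y → (x + y) ^ᴷ (p ^ e) ≡ x ^ᴷ (p ^ e) + y ^ᴷ (p ^ e)
    frobenius-^ zero    x y = distribʳ 1# x y
    frobenius-^ (suc e) x y = begin
      (x + y) ^ᴷ (p ℕ.* p ^ e)
        ≡⟨ sym (^-assocʳ (x + y) p (p ^ e)) ⟩
      ((x + y) ^ᴷ p) ^ᴷ (p ^ e)
        ≡⟨ cong (_^ᴷ (p ^ e)) (frobenius p-prime p×1≡0 x y) ⟩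
      (x ^ᴷ p + y ^ᴷ p) ^ᴷ (p ^ e)
        ≡⟨ frobenius-^ e (x ^ᴷ p) (y ^ᴷ p) ⟩
      (x ^ᴷ p) ^ᴷ (p ^ e) + (y ^ᴷ p) ^ᴷ (p ^ e)
        ≡⟨ cong₂ _+_ (^-assocʳ x p (p ^ e)) (^-assocʳ y p (p ^ e)) ⟩
      x ^ᴷ (p ℕ.* p ^ e) + y ^ᴷ (p ℕ.* p ^ e) ∎

    fixedField-isSubfield : ∀ e → IsSubfield (λ a → a ^ᴷ (p ^ e) ≡ a)
    fixedField-isSubfield e = record
      { 0#∈     = 0^q≡0
      ; 1#∈     = 1^n≡1 q
      ; +∈      = λ {a} {b} a^q≡a b^q≡b → trans (frobenius-^ e a b) (cong₂ _+_ a^q≡a b^q≡b)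
      ; -∈      = λ {a} a^q≡a → trans (-a^q≡-a^q a) (cong -_ a^q≡a)
      ; *∈      = λ {a} {b} a^q≡a b^q≡b → trans (^-distrib-* a b q) (cong₂ _*_ a^q≡a b^q≡b)
      ; invert∈ = invert-fixed
      }
      where
      q = p ^ e
      0^q≡0 : 0# ^ᴷ q ≡ 0#
      0^q≡0 = x+x≈x⇒x≈0 _ (trans (sym (frobenius-^ e 0# 0#)) (cong (_^ᴷ q) (+-identityˡ 0#)))
      -a^q≡-a^q : ∀ a → (- a) ^ᴷ q ≡ - (a ^ᴷ q)
      -a^q≡-a^q a = +-inverseʳ-unique (a ^ᴷ q) _
        (trans (sym (frobenius-^ e a (- a))) (trans (cong (_^ᴷ q) (-‿inverseʳ a)) 0^q≡0))
      invert-fixed : ∀ {a} (a≢0 : a ≢ 0#) → a ^ᴷ q ≡ a → invert a a≢0 ^ᴷ q ≡ invert a a≢0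
      invert-fixed {a} a≢0 a^q≡a = *-cancelʳ-nonzero a≢0 (begin
        a⁻¹ ^ᴷ q * a          ≡⟨ cong (a⁻¹ ^ᴷ q *_) (sym a^q≡a) ⟩
        a⁻¹ ^ᴷ q * a ^ᴷ q     ≡⟨ sym (^-distrib-* a⁻¹ a q) ⟩
        (a⁻¹ * a) ^ᴷ q        ≡⟨ cong (_^ᴷ q) (*-inverseˡ a a≢0) ⟩
        1# ^ᴷ q               ≡⟨ 1^n≡1 q ⟩
        1#                    ≡⟨ sym (*-inverseˡ a a≢0) ⟩
        a⁻¹ * a               ∎)
        where a⁻¹ = invert a a≢0

  InFq-isSubfield : ∀ {p} → Prime p → ∀ m n → card ≡ (p ^ m) ^ n → IsSubfield (InFq K (p ^ m))
  InFq-isSubfield {p} p-prime m n card≡q^n =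
    IsSubfield-resp (trans (^≡^ᴷ _ (p ^ m))) (trans (sym (^≡^ᴷ _ (p ^ m))))
      (fixedField-isSubfield p-prime p×1≡0 m)
    where
    p×1≡0 : p ×ᴷ 1# ≡ 0#
    p×1≡0 = Characteristic.card≡p^e⇒p×1≡0 K p (m ℕ.* n) (trans card≡q^n (ℕₚ.^-*-assoc p m n))

module LinearAlgebra (K : FiniteField) {F : FiniteField.Carrier K → Set}
                     (F-subfield : Subfields.IsSubfield K F) where
  open FiniteField K hiding (_^_)
  open FieldProperties K
  open Sums K
  open Matrices K using (idM-diagonal; idM-offDiagonal)
  open Subfields.IsSubfield F-subfield
  open ≡-Reasoning

  Independent : ∀ {k} → (Fin k → Carrier) → Set
  Independent {k} v =
    ∀ (c : Fin k → Carrier) → (∀ i → F (c i)) → linComb K c v ≡ 0# → ∀ i → c i ≡ 0#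

  InSpan : ∀ {m} → (Fin m → Carrier) → Carrier → Set
  InSpan {m} w x = Σ (Fin m → Carrier) λ c → (∀ i → F (c i)) × linComb K c w ≡ x

  independent⇒nonzero : ∀ {k} {v : Fin k → Carrier} → Independent v → ∀ l → v l ≢ 0#
  independent⇒nonzero {v = v} v-independent l v≡0 =
    1≢0 (trans (sym (idM-diagonal l)) (v-independent eₗ eₗ∈ eₗ·v≡0 l))
    where
    eₗ : Fin _ → Carrier
    eₗ i = idM K i l
    eₗ∈ : ∀ i → F (eₗ i)
    eₗ∈ i with i Fin.≟ l
    ... | yes _ = 1#∈
    ... | no  _ = 0#∈
    eₗ·v≡0 : linComb K eₗ v ≡ 0#
    eₗ·v≡0 = begin
      linComb K eₗ v
        ≡⟨ ΣK-single l _ (λ i i≢l → trans (cong (_* v i) (idM-offDiagonal i≢l)) (zeroˡ (v i))) ⟩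
      eₗ l * v l
        ≡⟨ cong (eₗ l *_) v≡0 ⟩
      eₗ l * 0#
        ≡⟨ zeroʳ _ ⟩
      0# ∎

  InSpan-tail : ∀ {m x} {w : Fin (suc m) → Carrier} (x∈ : InSpan w x) →
    proj₁ x∈ zero ≡ 0# → InSpan (w ∘ suc) x
  InSpan-tail {x = x} {w} (c , c∈ , c·w≡x) c₀≡0 = c ∘ suc , c∈ ∘ suc , (begin
    linComb K (c ∘ suc) (w ∘ suc)        ≡⟨ sym (+-identityˡ _) ⟩
    0# + linComb K (c ∘ suc) (w ∘ suc)   ≡⟨ cong (_+ linComb K (c ∘ suc) (w ∘ suc)) (sym c₀w₀≡0) ⟩
    linComb K c w                        ≡⟨ c·w≡x ⟩
    x                                    ∎)
    where
    c₀w₀≡0 : c zero * w zero ≡ 0#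
    c₀w₀≡0 = trans (cong (_* w zero) c₀≡0) (zeroˡ (w zero))

  -- One step of the Steinitz exchange: v l₀ has a nonzero w₀-coordinate γ, so subtracting
  -- suitable multiples of v l₀ from the other vectors removes their w₀-coordinates.
  module Exchange {k m} (v : Fin (suc k) → Carrier) (w : Fin (suc m) → Carrier)
                  (v∈ : ∀ l → InSpan w (v l))
                  (l₀ : Fin (suc k)) (γ≢0 : proj₁ (v∈ l₀) zero ≢ 0#) where

    c : Fin (suc k) → Fin (suc m) → Carrier
    c l = proj₁ (v∈ l)

    c∈ : ∀ l i → F (c l i)
    c∈ l = proj₁ (proj₂ (v∈ l))

    c·w≡v : ∀ l → linComb K (c l) w ≡ v l
    c·w≡v l = proj₂ (proj₂ (v∈ l))

    γ : Carrier
    γ = c l₀ zero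

    δ : Fin k → Carrier
    δ j = - (c (punchIn l₀ j) zero * invert γ γ≢0)

    δ∈ : ∀ j → F (δ j)
    δ∈ j = -∈ (*∈ (c∈ (punchIn l₀ j) zero) (invert∈ γ≢0 (c∈ l₀ zero)))

    v′ : Fin k → Carrier
    v′ j = v (punchIn l₀ j) + δ j * v l₀

    v′∈span : ∀ j → InSpan (w ∘ suc) (v′ j)
    v′∈span j = c′ , c′∈ , (begin
      linComb K c′ (w ∘ suc)
        ≡⟨ ΣK-linearˡ (c l ∘ suc) (c l₀ ∘ suc) (w ∘ suc) (δ j) ⟩
      s + δ j * t
        ≡⟨ sym (a+db≡0⇒[aw+s]+d[bw+t]≡s+dt (c l zero) γ (δ j) s t (w zero) (x+[-xy⁻¹]y≡0 _ γ γ≢0)) ⟩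
      (c l zero * w zero + s) + δ j * (γ * w zero + t)
        ≡⟨ cong₂ (λ x y → x + δ j * y) (c·w≡v l) (c·w≡v l₀) ⟩
      v′ j ∎)
      where
      l = punchIn l₀ j
      c′ : Fin m → Carrier
      c′ i = c l (suc i) + δ j * c l₀ (suc i)
      c′∈ : ∀ i → F (c′ i)
      c′∈ i = +∈ (c∈ l (suc i)) (*∈ (δ∈ j) (c∈ l₀ (suc i)))
      s = linComb K (c l ∘ suc) (w ∘ suc)
      t = linComb K (c l₀ ∘ suc) (w ∘ suc)

    v′-independent : Independent v → Independent v′
    v′-independent v-independent d d∈ d·v′≡0 j = begin
      d j               ≡⟨ sym (insertAt-punchIn d l₀ E j) ⟩
      e (punchIn l₀ j)  ≡⟨ v-independent e e∈ e·v≡0 (punchIn l₀ j) ⟩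
      0#                ∎
      where
      E = ΣK K (λ i → d i * δ i)
      e = insertAt d l₀ E
      e∈ : ∀ l → F (e l)
      e∈ = insertAt-∀ {P = F} d l₀ (ΣK∈ _ (λ i → *∈ (d∈ i) (δ∈ i))) d∈
      e·v≡0 : linComb K e v ≡ 0#
      e·v≡0 = begin
        linComb K e v
          ≡⟨ ΣK-remove l₀ (λ l → e l * v l) ⟩
        e l₀ * v l₀ + ΣK K (λ i → e (punchIn l₀ i) * v (punchIn l₀ i))
          ≡⟨ cong₂ _+_ (cong (_* v l₀) (insertAt-lookup d l₀ E))
                       (ΣK-cong (λ i → cong (_* v (punchIn l₀ i)) (insertAt-punchIn d l₀ E i))) ⟩
        E * v l₀ + ΣK K (λ i → d i * v (punchIn l₀ i))
          ≡⟨ +-comm _ _ ⟩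
        ΣK K (λ i → d i * v (punchIn l₀ i)) + E * v l₀
          ≡⟨ sym (ΣK-linearʳ d (v ∘ punchIn l₀) δ (v l₀)) ⟩
        linComb K d v′
          ≡⟨ d·v′≡0 ⟩
        0# ∎

  steinitz : ∀ {k m} (v : Fin k → Carrier) (w : Fin m → Carrier) →
    Independent v → (∀ l → InSpan w (v l)) → k ≤ m
  steinitz {zero}          v w _             _  = z≤n
  steinitz {suc k} {zero}  v w v-independent v∈ =
    ⊥-elim (independent⇒nonzero {v = v} v-independent zero (sym (proj₂ (proj₂ (v∈ zero)))))
  steinitz {suc k} {suc m} v w v-independent v∈ with any? (λ l → ¬? (proj₁ (v∈ l) zero ≟ 0#))
  ... | yes (l₀ , γ≢0) = s≤s (steinitz v′ (w ∘ suc) (v′-independent v-independent) v′∈span)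
    where open Exchange v w v∈ l₀ γ≢0
  ... | no  ∄γ≢0       = ℕₚ.m≤n⇒m≤1+n (steinitz v (w ∘ suc) v-independent v∈tail)
    where
    v∈tail : ∀ l → InSpan (w ∘ suc) (v l)
    v∈tail l = InSpan-tail {w = w} (v∈ l) (decidable-stable (proj₁ (v∈ l) zero ≟ 0#) (∄γ≢0 ∘ (l ,_)))

module Automorphism (K : FiniteField) {σ : FiniteField.Carrier K → FiniteField.Carrier K}
                    (σ-automorphism : IsAutomorphism K σ) where
  open FiniteField K hiding (_^_)
  open FieldProperties K using (+-identityˡ; x+x≈x⇒x≈0; _^ᴷ_; ^≡^ᴷ)
  open ≡-Reasoning

  σ-+ : ∀ x y → σ (x + y) ≡ σ x + σ y
  σ-+ = proj₁ σ-automorphism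

  σ-* : ∀ x y → σ (x * y) ≡ σ x * σ y
  σ-* = proj₁ (proj₂ σ-automorphism)

  σ-1 : σ 1# ≡ 1#
  σ-1 = proj₁ (proj₂ (proj₂ σ-automorphism))

  σ⁻¹ : Carrier → Carrier
  σ⁻¹ = proj₁ (proj₂ (proj₂ (proj₂ σ-automorphism)))

  σ⁻¹-σ : ∀ x → σ⁻¹ (σ x) ≡ x
  σ⁻¹-σ = proj₁ (proj₂ (proj₂ (proj₂ (proj₂ σ-automorphism))))

  σ-σ⁻¹ : ∀ x → σ (σ⁻¹ x) ≡ x
  σ-σ⁻¹ = proj₂ (proj₂ (proj₂ (proj₂ (proj₂ σ-automorphism))))

  σ-injective : ∀ {x y} → σ x ≡ σ y → x ≡ y
  σ-injective {x} {y} σx≡σy = trans (sym (σ⁻¹-σ x)) (trans (cong σ⁻¹ σx≡σy) (σ⁻¹-σ y))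

  σ-0 : σ 0# ≡ 0#
  σ-0 = x+x≈x⇒x≈0 (σ 0#) (trans (sym (σ-+ 0# 0#)) (cong σ (+-identityˡ 0#)))

  σ-ΣK : ∀ {m} (f : Fin m → Carrier) → σ (ΣK K f) ≡ ΣK K (σ ∘ f)
  σ-ΣK {zero}  f = σ-0
  σ-ΣK {suc m} f = trans (σ-+ (f zero) _) (cong (σ (f zero) +_) (σ-ΣK (f ∘ suc)))

  σ-^ : ∀ x n → σ (x ^ᴷ n) ≡ σ x ^ᴷ n
  σ-^ x zero    = σ-1
  σ-^ x (suc n) = trans (σ-* x (x ^ᴷ n)) (cong (σ x *_) (σ-^ x n))

  σ⁻¹-InFq : ∀ {q a} → InFq K q a → InFq K q (σ⁻¹ a)
  σ⁻¹-InFq {q} {a} a^q≡a = σ-injective (begin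
    σ (FiniteField._^_ K (σ⁻¹ a) q)  ≡⟨ cong σ (^≡^ᴷ (σ⁻¹ a) q) ⟩
    σ (σ⁻¹ a ^ᴷ q)                   ≡⟨ σ-^ (σ⁻¹ a) q ⟩
    σ (σ⁻¹ a) ^ᴷ q                   ≡⟨ cong (_^ᴷ q) (σ-σ⁻¹ a) ⟩
    a ^ᴷ q                           ≡⟨ trans (sym (^≡^ᴷ a q)) a^q≡a ⟩
    a                                ≡⟨ sym (σ-σ⁻¹ a) ⟩
    σ (σ⁻¹ a)                        ∎)

  σ⁻¹-nonzero : ∀ {x} → x ≢ 0# → σ⁻¹ x ≢ 0#
  σ⁻¹-nonzero {x} x≢0 σ⁻¹x≡0 = x≢0 (trans (sym (σ-σ⁻¹ x)) (trans (cong σ σ⁻¹x≡0) σ-0))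

  σ⁻¹-+ : ∀ x y → σ⁻¹ (x + y) ≡ σ⁻¹ x + σ⁻¹ y
  σ⁻¹-+ x y = σ-injective (begin
    σ (σ⁻¹ (x + y))            ≡⟨ σ-σ⁻¹ (x + y) ⟩
    x + y                      ≡⟨ sym (cong₂ _+_ (σ-σ⁻¹ x) (σ-σ⁻¹ y)) ⟩
    σ (σ⁻¹ x) + σ (σ⁻¹ y)      ≡⟨ sym (σ-+ (σ⁻¹ x) (σ⁻¹ y)) ⟩
    σ (σ⁻¹ x + σ⁻¹ y)          ∎)

  σ⁻¹-* : ∀ x y → σ⁻¹ (x * y) ≡ σ⁻¹ x * σ⁻¹ y
  σ⁻¹-* x y = σ-injective (begin
    σ (σ⁻¹ (x * y))            ≡⟨ σ-σ⁻¹ (x * y) ⟩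
    x * y                      ≡⟨ sym (cong₂ _*_ (σ-σ⁻¹ x) (σ-σ⁻¹ y)) ⟩
    σ (σ⁻¹ x) * σ (σ⁻¹ y)      ≡⟨ sym (σ-* (σ⁻¹ x) (σ⁻¹ y)) ⟩
    σ (σ⁻¹ x * σ⁻¹ y)          ∎)

  σ⁻¹-1 : σ⁻¹ 1# ≡ 1#
  σ⁻¹-1 = σ-injective (trans (σ-σ⁻¹ 1#) (sym σ-1))

  σ⁻¹-automorphism : IsAutomorphism K σ⁻¹
  σ⁻¹-automorphism = σ⁻¹-+ , σ⁻¹-* , σ⁻¹-1 , σ , σ-σ⁻¹ , σ⁻¹-σ

module Dimension (K : FiniteField) (q : ℕ) (Fq-subfield : Subfields.IsSubfield K (InFq K q)) where
  open FiniteField K hiding (_^_)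
  open FieldProperties K
  open Sums K
  open LinearAlgebra K Fq-subfield
  open ≡-Reasoning

  scaled-automorphism-preserves-independence : ∀ {σ a k} {u : Fin k → Carrier} →
    IsAutomorphism K σ → a ≢ 0# → Independent u → Independent (λ l → a * σ (u l))
  scaled-automorphism-preserves-independence {σ} {a} {u = u} σ-automorphism a≢0 u-independent
    c c∈ c·au≡0 l = begin
      c l              ≡⟨ sym (σ-σ⁻¹ (c l)) ⟩
      σ (σ⁻¹ (c l))    ≡⟨ cong σ (u-independent (σ⁻¹ ∘ c) (σ⁻¹-InFq {q} ∘ c∈) σ⁻¹c·u≡0 l) ⟩
      σ 0#             ≡⟨ σ-0 ⟩
      0#               ∎
    where
    open Automorphism K σ-automorphism
    c·σu≡0 : ΣK K (λ l → c l * σ (u l)) ≡ 0#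
    c·σu≡0 = x≢0⇒x*y≡0⇒y≡0 a≢0 (begin
      a * ΣK K (λ l → c l * σ (u l))    ≡⟨ *-distribˡ-ΣK a (λ l → c l * σ (u l)) ⟩
      ΣK K (λ l → a * (c l * σ (u l)))  ≡⟨ ΣK-cong (λ l → *-Semigroup.x∙yz≈y∙xz a (c l) (σ (u l))) ⟩
      ΣK K (λ l → c l * (a * σ (u l)))  ≡⟨ c·au≡0 ⟩
      0#                                ∎)
    σ⁻¹c·u≡0 : linComb K (σ⁻¹ ∘ c) u ≡ 0#
    σ⁻¹c·u≡0 = σ-injective (begin
      σ (linComb K (σ⁻¹ ∘ c) u)
        ≡⟨ σ-ΣK (λ l → σ⁻¹ (c l) * u l) ⟩
      ΣK K (λ l → σ (σ⁻¹ (c l) * u l))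
        ≡⟨ ΣK-cong (λ l → trans (σ-* _ _) (cong (_* σ (u l)) (σ-σ⁻¹ (c l)))) ⟩
      ΣK K (λ l → c l * σ (u l))
        ≡⟨ c·σu≡0 ⟩
      0#
        ≡⟨ sym σ-0 ⟩
      σ 0# ∎)

  dim-≤-under-scaled-automorphism : ∀ {σ a} {V V′ : Carrier → Set} {k k′} →
    IsAutomorphism K σ → a ≢ 0# → (∀ x → V x → V′ (a * σ x)) →
    HasDim K q V k → HasDim K q V′ k′ → k ≤ k′
  dim-≤-under-scaled-automorphism {σ} {a} σ-automorphism a≢0 V→V′
    (u , u∈V , u-independent , _) (w , _ , _ , w-spans) =
    steinitz (λ l → a * σ (u l)) w
      (scaled-automorphism-preserves-independence σ-automorphism a≢0 u-independent)
      (λ l → w-spans (a * σ (u l)) (V→V′ (u l) (u∈V l)))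

module SemilinearEquivalence (K : FiniteField) {q r} (U W : Fin r → Subspace K q)
  (A B : Matrix K r) (B⊗A≡I : ∀ i j → (_⊗_ K B A) i j ≡ idM K i j)
  {σ : FiniteField.Carrier K → FiniteField.Carrier K} (σ-automorphism : IsAutomorphism K σ)
  (forward : ∀ x → InProduct K U x → InProduct K W (semilinear K A σ x))
  (backward : ∀ y → InProduct K W y →
    Σ (Fin r → FiniteField.Carrier K) λ x → InProduct K U x × (∀ i → semilinear K A σ x i ≡ y i))
  where
  open FiniteField K hiding (_^_)
  open FieldProperties K using (zeroʳ)
  open Sums K
  open Matrices K
  open Automorphism K σ-automorphism
  open ≡-Reasoning

  unitVector : Fin r → Carrier → Fin r → Carrier
  unitVector j x = updateAt (λ _ → 0#) j (λ _ → x)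

  unitVector∈ : ∀ (V : Fin r → Subspace K q) j {x} → mem (V j) x → InProduct K V (unitVector j x)
  unitVector∈ V j x∈ i with i Fin.≟ j
  ... | yes refl = subst (mem (V j)) (sym (updateAt-updates j (λ _ → 0#))) x∈
  ... | no  i≢j  = subst (mem (V i)) (sym (updateAt-minimal i j (λ _ → 0#) i≢j)) (0∈ (V i))

  ΣK-unitVector : ∀ (row : Fin r → Carrier) (g : Carrier → Carrier) → g 0# ≡ 0# →
    ∀ j x → ΣK K (λ m → row m * g (unitVector j x m)) ≡ row j * g x
  ΣK-unitVector row g g0≡0 j x = trans
    (ΣK-single j _ (λ m m≢j → trans (cong (λ u → row m * g u) (updateAt-minimal m j (λ _ → 0#) m≢j))
                                    (trans (cong (row m *_) g0≡0) (zeroʳ (row m)))))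
    (cong (λ u → row j * g u) (updateAt-updates j (λ _ → 0#)))

  U⇒W : ∀ i j x → mem (U j) x → mem (W i) (A i j * σ x)
  U⇒W i j x x∈ = subst (mem (W i)) (ΣK-unitVector (A i) σ σ-0 j x) (forward _ (unitVector∈ U j x∈) i)

  W⇒U : ∀ i j w → mem (W i) w → mem (U j) (σ⁻¹ (B j i) * σ⁻¹ w)
  W⇒U i j w w∈ = subst (mem (U j)) xⱼ≡ (x∈ j)
    where
    preimage = backward (unitVector i w) (unitVector∈ W i w∈)
    x = proj₁ preimage
    x∈ = proj₁ (proj₂ preimage)
    σxⱼ≡ : σ (x j) ≡ B j i * w
    σxⱼ≡ = begin
      σ (x j)
        ≡⟨ sym (left-inverse-· A B B⊗A≡I (σ ∘ x) j) ⟩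
      (B ·ᴷ A ·ᴷ (σ ∘ x)) j
        ≡⟨ ΣK-cong (λ m → cong (B j m *_) (proj₂ (proj₂ preimage) m)) ⟩
      ΣK K (λ m → B j m * unitVector i w m)
        ≡⟨ ΣK-unitVector (B j) (λ u → u) refl i w ⟩
      B j i * w ∎
    xⱼ≡ : x j ≡ σ⁻¹ (B j i) * σ⁻¹ w
    xⱼ≡ = trans (sym (σ⁻¹-σ (x j))) (trans (cong σ⁻¹ σxⱼ≡) (σ⁻¹-* (B j i) w))

module GaussianElimination (K : FiniteField) where
  open FiniteField K hiding (_^_)
  open FieldProperties K
  open Sums K
  open Matrices K

  -- Clearing column 0 with the pivot row i₀ of A, then deleting that row and column, keeps
  -- A and B mutually inverse once row 0 and column i₀ of B are deleted as well.
  module Elimination {r} (A B : Matrix K (suc r))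
    (A⊗B≡I : ∀ i j → (A ⊗ᴷ B) i j ≡ idM K i j) (B⊗A≡I : ∀ i j → (B ⊗ᴷ A) i j ≡ idM K i j)
    (i₀ : Fin (suc r)) (γ≢0 : A i₀ zero ≢ 0#) where
    open ≡-Reasoning

    γ⁻¹ : Carrier
    γ⁻¹ = invert (A i₀ zero) γ≢0

    μ : Fin r → Carrier
    μ i = - (A (punchIn i₀ i) zero * γ⁻¹)

    A′ : Matrix K r
    A′ i j = A (punchIn i₀ i) (suc j) + μ i * A i₀ (suc j)

    B′ : Matrix K r
    B′ j i = B (suc j) (punchIn i₀ i)

    A′-support : ∀ i j → A′ i j ≢ 0# →
      A (punchIn i₀ i) (suc j) ≢ 0# ⊎ (A i₀ (suc j) ≢ 0# × A (punchIn i₀ i) zero ≢ 0#)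
    A′-support i j A′ᵢⱼ≢0 with A (punchIn i₀ i) (suc j) ≟ 0#
    ... | no  a≢0 = inj₁ a≢0
    ... | yes a≡0 = inj₂ (x*y≢0⇒y≢0 μg≢0 , μ≢0⇒c≢0 (x*y≢0⇒x≢0 μg≢0))
      where
      μg≢0 : μ i * A i₀ (suc j) ≢ 0#
      μg≢0 μg≡0 = A′ᵢⱼ≢0 (trans (cong₂ _+_ a≡0 μg≡0) (+-identityˡ 0#))
      μ≢0⇒c≢0 : μ i ≢ 0# → A (punchIn i₀ i) zero ≢ 0#
      μ≢0⇒c≢0 μ≢0 c≡0 = μ≢0 (trans (cong (λ c → - (c * γ⁻¹)) c≡0) (trans (cong -_ (zeroˡ γ⁻¹)) -0#≈0#))

    A′⊗B′≡I : ∀ i l → (A′ ⊗ᴷ B′) i l ≡ idM K i l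
    A′⊗B′≡I i l = begin
      (A′ ⊗ᴷ B′) i l
        ≡⟨ ΣK-linearˡ (λ j → A (punchIn i₀ i) (suc j)) (λ j → A i₀ (suc j)) (λ j → B′ j l) (μ i) ⟩
      Sab + μ i * Sgb
        ≡⟨ cong (λ u → Sab + μ i * u) Sgb≡-γβ ⟩
      Sab + μ i * - (A i₀ zero * β)
        ≡⟨ cong (Sab +_) μ[-γβ]≡cβ ⟩
      Sab + c * β
        ≡⟨ +-comm Sab (c * β) ⟩
      (A ⊗ᴷ B) (punchIn i₀ i) (punchIn i₀ l)
        ≡⟨ A⊗B≡I (punchIn i₀ i) (punchIn i₀ l) ⟩
      idM K (punchIn i₀ i) (punchIn i₀ l)
        ≡⟨ idM-injective (punchIn i₀) (punchIn-injective i₀ _ _) i l ⟩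
      idM K i l ∎
      where
      c = A (punchIn i₀ i) zero
      β = B zero (punchIn i₀ l)
      Sab = ΣK K (λ j → A (punchIn i₀ i) (suc j) * B′ j l)
      Sgb = ΣK K (λ j → A i₀ (suc j) * B′ j l)
      Sgb≡-γβ : Sgb ≡ - (A i₀ zero * β)
      Sgb≡-γβ = +-inverseʳ-unique (A i₀ zero * β) Sgb
        (trans (A⊗B≡I i₀ (punchIn i₀ l)) (idM-offDiagonal (punchInᵢ≢i i₀ l ∘ sym)))
      μ[-γβ]≡cβ : μ i * - (A i₀ zero * β) ≡ c * β
      μ[-γβ]≡cβ = begin
        - (c * γ⁻¹) * - (A i₀ zero * β)     ≡⟨ sym (-‿distribˡ-* (c * γ⁻¹) _) ⟩
        - (c * γ⁻¹ * - (A i₀ zero * β))     ≡⟨ cong -_ (sym (-‿distribʳ-* (c * γ⁻¹) _)) ⟩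
        - - (c * γ⁻¹ * (A i₀ zero * β))     ≡⟨ -‿involutive _ ⟩
        c * γ⁻¹ * (A i₀ zero * β)           ≡⟨ *-assoc c γ⁻¹ _ ⟩
        c * (γ⁻¹ * (A i₀ zero * β))         ≡⟨ cong (c *_) (sym (*-assoc γ⁻¹ (A i₀ zero) β)) ⟩
        c * (γ⁻¹ * A i₀ zero * β)           ≡⟨ cong (λ u → c * (u * β)) (*-inverseˡ (A i₀ zero) γ≢0) ⟩
        c * (1# * β)                        ≡⟨ cong (c *_) (*-identityˡ β) ⟩
        c * β                               ∎

    B′⊗A′≡I : ∀ j m → (B′ ⊗ᴷ A′) j m ≡ idM K j m
    B′⊗A′≡I j m = begin
      (B′ ⊗ᴷ A′) j m                        ≡⟨ ΣK-linearʳ (B′ j) (λ i → A (punchIn i₀ i) (suc m)) μ g ⟩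
      Sba + Sbμ * g                         ≡⟨ cong (λ u → Sba + u * g) Sbμ≡β ⟩
      Sba + β * g                           ≡⟨ +-comm Sba (β * g) ⟩
      β * g + Sba                           ≡⟨ sym (ΣK-remove i₀ (λ l → B (suc j) l * A l (suc m))) ⟩
      (B ⊗ᴷ A) (suc j) (suc m)              ≡⟨ B⊗A≡I (suc j) (suc m) ⟩
      idM K (suc j) (suc m)                 ≡⟨ idM-injective suc suc-injective j m ⟩
      idM K j m                             ∎
      where
      g = A i₀ (suc m)
      β = B (suc j) i₀
      Sba = ΣK K (λ i → B′ j i * A (punchIn i₀ i) (suc m))
      Sbμ = ΣK K (λ i → B′ j i * μ i)
      Sbc = ΣK K (λ i → B′ j i * A (punchIn i₀ i) zero)
      Sbc≡-βγ : Sbc ≡ - (β * A i₀ zero)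
      Sbc≡-βγ = +-inverseʳ-unique (β * A i₀ zero) Sbc
        (trans (sym (ΣK-remove i₀ (λ l → B (suc j) l * A l zero)))
               (trans (B⊗A≡I (suc j) zero) (idM-offDiagonal {i = suc j} {zero} λ ())))
      Sbμ≡β : Sbμ ≡ β
      Sbμ≡β = begin
        Sbμ
          ≡⟨ ΣK-cong (λ i → trans (sym (-‿distribʳ-* (B′ j i) _)) (cong -_ (sym (*-assoc (B′ j i) _ γ⁻¹)))) ⟩
        ΣK K (λ i → - (B′ j i * A (punchIn i₀ i) zero * γ⁻¹))
          ≡⟨ sym (-‿distrib-ΣK (λ i → B′ j i * A (punchIn i₀ i) zero * γ⁻¹)) ⟩
        - ΣK K (λ i → B′ j i * A (punchIn i₀ i) zero * γ⁻¹)
          ≡⟨ cong -_ (sym (*-distribʳ-ΣK γ⁻¹ (λ i → B′ j i * A (punchIn i₀ i) zero))) ⟩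
        - (Sbc * γ⁻¹)
          ≡⟨ cong (λ u → - (u * γ⁻¹)) Sbc≡-βγ ⟩
        - (- (β * A i₀ zero) * γ⁻¹)
          ≡⟨ cong -_ (sym (-‿distribˡ-* (β * A i₀ zero) γ⁻¹)) ⟩
        - - (β * A i₀ zero * γ⁻¹)
          ≡⟨ -‿involutive _ ⟩
        β * A i₀ zero * γ⁻¹
          ≡⟨ *-assoc β _ γ⁻¹ ⟩
        β * (A i₀ zero * γ⁻¹)
          ≡⟨ cong (β *_) (*-inverseʳ (A i₀ zero) γ≢0) ⟩
        β * 1#
          ≡⟨ *-identityʳ β ⟩
        β ∎

  weight-respecting-inverses⇒permutation : ∀ {r} (A B : Matrix K r) (k k′ : Fin r → ℕ) →
    (∀ i j → (A ⊗ᴷ B) i j ≡ idM K i j) → (∀ i j → (B ⊗ᴷ A) i j ≡ idM K i j) →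
    (∀ i j → A i j ≢ 0# → k j ≤ k′ i) → (∀ i j → B j i ≢ 0# → k′ i ≤ k j) →
    IsPermutationOf k k′
  weight-respecting-inverses⇒permutation {zero}  A B k k′ _ _ _ _ = Perm.id , λ ()
  weight-respecting-inverses⇒permutation {suc r} A B k k′ A⊗B≡I B⊗A≡I A-weights B-weights =
    Perm.insert zero i₀ π , k≗k′∘π
    where
    pivot : Σ (Fin (suc r)) λ i → B zero i * A i zero ≢ 0#
    pivot = ΣK≢0⇒∃≢0 (λ i → B zero i * A i zero)
      (λ Σ≡0 → 1≢0 (trans (sym (idM-diagonal {suc r} zero)) (trans (sym (B⊗A≡I zero zero)) Σ≡0)))
    i₀ = proj₁ pivot
    γ≢0 : A i₀ zero ≢ 0#
    γ≢0 = x*y≢0⇒y≢0 (proj₂ pivot)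
    k′i₀≤k₀ : k′ i₀ ≤ k zero
    k′i₀≤k₀ = B-weights i₀ zero (x*y≢0⇒x≢0 (proj₂ pivot))
    open Elimination A B A⊗B≡I B⊗A≡I i₀ γ≢0
    A′-weights : ∀ i j → A′ i j ≢ 0# → k (suc j) ≤ k′ (punchIn i₀ i)
    A′-weights i j A′ᵢⱼ≢0 with A′-support i j A′ᵢⱼ≢0
    ... | inj₁ a≢0         = A-weights _ _ a≢0
    ... | inj₂ (g≢0 , c≢0) = begin
      k (suc j)             ≤⟨ A-weights i₀ (suc j) g≢0 ⟩
      k′ i₀                 ≤⟨ k′i₀≤k₀ ⟩
      k zero                ≤⟨ A-weights _ zero c≢0 ⟩
      k′ (punchIn i₀ i)     ∎
      where open ℕₚ.≤-Reasoning
    reduced = weight-respecting-inverses⇒permutation A′ B′ (k ∘ suc) (k′ ∘ punchIn i₀)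
      A′⊗B′≡I B′⊗A′≡I A′-weights (λ i j → B-weights (punchIn i₀ i) (suc j))
    π = proj₁ reduced
    k≗k′∘π : ∀ j → k j ≡ k′ (Perm.insert zero i₀ π ⟨$⟩ʳ j)
    k≗k′∘π zero    = ℕₚ.≤-antisym (A-weights i₀ zero γ≢0) k′i₀≤k₀
    k≗k′∘π (suc j) = trans (proj₂ reduced j) (cong k′ (sym (Perm.insert-punchIn zero i₀ π j)))

corollary4p3 : (q n r : ℕ) → IsPrimePower q → 1 ≤ n → 1 ≤ r →
    (K : FiniteField) → FiniteField.card K ≡ q ^ n →
    (U W : Fin r → Subspace K q) →
    Distinct K U → Distinct K W →
    ScatteredCond K U → ScatteredCond K W →
    (k k′ : Fin r → ℕ) →
    (∀ i → HasDim K q (mem (U i)) (k i)) →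
    (∀ i → HasDim K q (mem (W i)) (k′ i)) →
    ¬ IsPermutationOf k k′ →
    ¬ Equivalent K U W
corollary4p3 .(p ^ m) n r (p , m , p-prime , _ , refl) _ _ K card≡q^n U W _ _ _ _ k k′ dim-U dim-W k≁k′
  (A , σ , (B , A⊗B≡I , B⊗A≡I) , σ-automorphism , forward , backward) =
  k≁k′ (weight-respecting-inverses⇒permutation A B k k′ A⊗B≡I B⊗A≡I A-weights B-weights)
  where
  open GaussianElimination K using (weight-respecting-inverses⇒permutation)
  open Dimension K (p ^ m) (Subfields.InFq-isSubfield K p-prime m n card≡q^n)
  open SemilinearEquivalence K U W A B B⊗A≡I σ-automorphism forward backward
  open Automorphism K σ-automorphism using (σ⁻¹-automorphism; σ⁻¹-nonzero)
  A-weights : ∀ i j → A i j ≢ FiniteField.0# K → k j ≤ k′ i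
  A-weights i j Aᵢⱼ≢0 =
    dim-≤-under-scaled-automorphism σ-automorphism Aᵢⱼ≢0 (U⇒W i j) (dim-U j) (dim-W i)
  B-weights : ∀ i j → B j i ≢ FiniteField.0# K → k′ i ≤ k j
  B-weights i j Bⱼᵢ≢0 =
    dim-≤-under-scaled-automorphism σ⁻¹-automorphism (σ⁻¹-nonzero Bⱼᵢ≢0) (W⇒U i j) (dim-W i) (dim-U j)
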